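{- Let $G=(V^+,V^-;E)$ be a DM-irreducible balanced bipartite graph, let $M$ be a perfect matching in $G$, and let $r\in V^+$. Then every spanning in-arborescence of $G_M$ rooted at $r$ contains all the edges of $\overleftarrow{M}=\{(v,u): \{u,v\}\in M,\ u\in V^+,\ v\in V^-\}$.
   Context: A bipartite graph $G=(V^+,V^-;E)$ is balanced if $|V^+|=|V^-|$. For each edge $e=\{u,v\}$ with $u\in V^+$, $v\in V^-$ write $\overrightarrow{e}=(u,v)$ and $\overleftarrow{e}=(v,u)$; for a perfect matching $M$, the auxiliary digraph is $G_M=(V^+\cup V^-,\ \{\overrightarrow{e}:e\in E\}\cup\{\overleftarrow{e}:e\in M\})$. $G$ is DM-irreducible (its Dulmage–Mendelsohn decomposition has a single component) if and only if $G$ has a perfect matching $M$ with $G_M$ strongly connected. An in-arborescence rooted at $r$ is a connected digraph in which $r$ has out-degree $0$ and every other vertex has out-degree $1$; it is spanning in $G_M$ if it is a subgraph of $G_M$ containing all vertices. -}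

module Defs where

open import Data.Nat using (ℕ)
open import Data.Fin using (Fin)
open import Data.Sum using (_⊎_; inj₁; inj₂)
open import Data.Product using (Σ; _×_; _,_)
open import Data.Empty using (⊥)
open import Relation.Nullary using (¬_)
open import Relation.Binary.PropositionalEquality using (_≡_)
open import Relation.Binary.Construct.Closure.ReflexiveTransitive using (Star)
open import Relation.Binary.Construct.Closure.Symmetric using (SymClosure)

-- A balanced bipartite graph G = (V⁺, V⁻; E) with |V⁺| = |V⁻| = n:
-- V⁺ = Fin n, V⁻ = Fin n, and E u v means {u,v} ∈ E for u ∈ V⁺, v ∈ V⁻.
BipGraph : ℕ → Set₁
BipGraph n = Fin n → Fin n → Set

-- Vertex set V⁺ ∪ V⁻ : inj₁ = V⁺, inj₂ = V⁻.
Vertex : ℕ → Set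
Vertex n = Fin n ⊎ Fin n

record IsPerfectMatching {n : ℕ} (E M : BipGraph n) : Set where
  field
    sub       : ∀ u v → M u v → E u v
    cover⁺    : ∀ u → Σ (Fin n) (λ v → M u v)
    unique⁺   : ∀ u v v′ → M u v → M u v′ → v ≡ v′
    cover⁻    : ∀ v → Σ (Fin n) (λ u → M u v)
    unique⁻   : ∀ u u′ v → M u v → M u′ v → u ≡ u′

-- Arcs of the auxiliary digraph G_M: (u,v) for every edge {u,v} ∈ E and
-- (v,u) for every edge {u,v} ∈ M  (u ∈ V⁺, v ∈ V⁻).
data Arc {n : ℕ} (E M : BipGraph n) : Vertex n → Vertex n → Set where
  fwd : ∀ {u v} → E u v → Arc E M (inj₁ u) (inj₂ v)
  bwd : ∀ {u v} → M u v → Arc E M (inj₂ v) (inj₁ u)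

StronglyConnected : ∀ {V : Set} → (V → V → Set) → Set
StronglyConnected {V} A = ∀ (x y : V) → Star A x y

-- DM-irreducibility via the characterization given in the context:
-- G has a perfect matching M with G_M strongly connected.
DMIrreducible : ∀ {n} → BipGraph n → Set₁
DMIrreducible {n} E =
  Σ (BipGraph n) (λ M → IsPerfectMatching E M × StronglyConnected (Arc E M))

record IsSpanningInArborescence {V : Set} (A : V → V → Set) (r : V)
                                (T : V → V → Set) : Set where
  field
    sub         : ∀ x y → T x y → A x y
    root-out    : ∀ y → ¬ T r y
    out-exists  : ∀ x → ¬ (x ≡ r) → Σ V (λ y → T x y)
    out-unique  : ∀ x y y′ → T x y → T x y′ → y ≡ y′
    connected   : ∀ x y → Star (SymClosure T) x y

{-# OPTIONS --safe #-}
module Submission where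

-- In G_M the only arc leaving a vertex v ∈ V⁻ is the reversed matching arc
-- at v. Since v is not the root, a spanning in-arborescence must give v an
-- outgoing arc, and that arc can only be this one.

open import Defs
open import Data.Nat using (ℕ)
open import Data.Fin using (Fin)
open import Data.Sum using (inj₁; inj₂)
open import Data.Product using (_,_)
open import Relation.Nullary using (¬_)
open import Relation.Binary.PropositionalEquality using (_≡_; cong; subst)

module _ {V : Set} {A : V → V → Set} {r : V} {T : V → V → Set}
         (arb : IsSpanningInArborescence A r T) where
  open IsSpanningInArborescence arb

  out-forced : ∀ {x y} → ¬ x ≡ r → (∀ {z} → A x z → z ≡ y) → T x y
  out-forced {x} x≢r only-y with out-exists x x≢r
  ... | z , x→z = subst (T x) (only-y (sub x z x→z)) x→z

bwd-target : ∀ {n} {E M : BipGraph n} → IsPerfectMatching E M →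
             ∀ {u v y} → M u v → Arc E M (inj₂ v) y → y ≡ inj₁ u
bwd-target pm {u} m (bwd {u′} m′) = cong inj₁ (IsPerfectMatching.unique⁻ pm u′ u _ m′ m)

lemma5 : ∀ (n : ℕ) (E M : BipGraph n) → DMIrreducible E → IsPerfectMatching E M →
    (r : Fin n) (T : Vertex n → Vertex n → Set) →
    IsSpanningInArborescence (Arc E M) (inj₁ r) T →
    ∀ u v → M u v → T (inj₂ v) (inj₁ u)
lemma5 n E M _ pm r T arb u v m = out-forced arb (λ ()) (bwd-target pm m)
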